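{- Let $T$ be a rooted tree on vertex set $[n]$ and let $(T,p)$ be a parking function. Then $(T,p)$ is prime if and only if every edge of $T$ is used by $p$.
   Context: Edges of $T$ are oriented towards the root. Given $p\in[n]^n$, drivers $1,\dots,n$ arrive in order; driver $i$ goes to $p_i$ and parks there if unoccupied; otherwise she travels along the directed path towards the root and parks at the first unoccupied vertex; if none, she leaves. $(T,p)$ is a parking function if all drivers park. For $v\in[n]$, $T_v$ is the subtree induced by vertices having a directed path (possibly of length $0$) to $v$. A parking function $(T,p)$ is prime if for every non-root vertex $v$, $|T_v| < |\{i : p_i\in V(T_v)\}|$. An edge $e$ is used by $p$ if some driver, after failing to park at her preferred vertex, crosses $e$ during her search for an unoccupied vertex. -}

module Defs where

open import Data.Nat using (ℕ; zero; suc; _<_)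
open import Data.Fin using (Fin)
open import Data.Bool using (Bool; true; false; not; if_then_else_; _∨_)
open import Data.Maybe using (Maybe; just; nothing; Is-just)
open import Data.Product using (_×_; _,_; proj₁; proj₂; ∃)
open import Data.List using (List; []; _∷_; map; length; filter)
open import Data.List.Relation.Unary.All using (All)
open import Data.List.Relation.Unary.Any using (Any)
open import Data.List.Membership.Propositional using (_∈_)
open import Data.Fin.Properties using () renaming (_≟_ to _≟F_)
open import Data.Bool.Properties using () renaming (_≟_ to _≟B_)
open import Data.List using (allFin)
open import Function using (_∘_)
open import Relation.Nullary using (¬_; does)
open import Relation.Binary.PropositionalEquality using (_≡_; _≢_)

iterate : ∀ {A : Set} → (A → A) → ℕ → A → A
iterate f zero x = x
iterate f (suc k) x = f (iterate f k x)

-- A rooted tree on vertex set [n] = Fin n, edges oriented towards the root: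
-- each non-root vertex v has the single out-edge v → parent v; the root is
-- a fixed point of parent and every vertex reaches the root.
record RootedTree (n : ℕ) : Set where
  field
    root        : Fin n
    parent      : Fin n → Fin n
    parent-root : parent root ≡ root
    reaches     : ∀ v → ∃ λ k → iterate parent k v ≡ root
open RootedTree public

module _ {n : ℕ} (T : RootedTree n) where

  -- u ∈ V(T_v): u has a directed path to v. Paths in a tree on n vertices
  -- have length < n, so checking lengths 0..n is exact.
  pathTo : ℕ → Fin n → Fin n → Bool
  pathTo zero    u v = does (u ≟F v)
  pathTo (suc k) u v = does (iterate (parent T) (suc k) u ≟F v) ∨ pathTo k u v

  inSubtree : Fin n → Fin n → Bool
  inSubtree v u = pathTo n u v

  subtreeSize : Fin n → ℕ
  subtreeSize v = length (filter (λ u → inSubtree v u ≟B true) (allFin n))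

  driversIn : (Fin n → Fin n) → Fin n → ℕ
  driversIn p v = length (filter (λ i → inSubtree v (p i) ≟B true) (allFin n))

  Occupancy : Set
  Occupancy = Fin n → Bool

  -- Outcome of one driver: the list of vertices she left (i.e. she crossed
  -- the edge v → parent v for each listed v), and where she parked (if at all).
  Outcome : Set
  Outcome = List (Fin n) × Maybe (Fin n)

  -- search along the path to the root (fuel n suffices: a path has ≤ n vertices)
  search : ℕ → Occupancy → Fin n → Outcome
  search zero    occ v = [] , nothing
  search (suc f) occ v =
    if not (occ v) then ([] , just v)
    else (if does (v ≟F root T) then ([] , nothing)
          else (v ∷ proj₁ (search f occ (parent T v)) , proj₂ (search f occ (parent T v))))

  occupy : Occupancy → Maybe (Fin n) → Occupancy
  occupy occ nothing  = occ
  occupy occ (just w) u = if does (u ≟F w) then true else occ u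

  run : Occupancy → List (Fin n) → List Outcome
  run occ [] = []
  run occ (a ∷ as) = o ∷ run (occupy occ (proj₂ o)) as
    where o = search n occ a

  outcomes : (Fin n → Fin n) → List Outcome
  outcomes p = run (λ _ → false) (map p (allFin n))

  IsParkingFunction : (Fin n → Fin n) → Set
  IsParkingFunction p = All (λ o → Is-just (proj₂ o)) (outcomes p)

  IsPrime : (Fin n → Fin n) → Set
  IsPrime p = ∀ v → v ≢ root T → subtreeSize v < driversIn p v

  EdgeUsed : (Fin n → Fin n) → Fin n → Set
  EdgeUsed p v = Any (λ o → v ∈ proj₁ o) (outcomes p)

  AllEdgesUsed : (Fin n → Fin n) → Set
  AllEdgesUsed p = ∀ v → v ≢ root T → EdgeUsed p v

-- Fix a non-root vertex v.  A driver preferring a vertex of T_v either parks in T_v, or leaves T_v,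
-- which she can only do by crossing the edge v → parent v, and never returns.  Summing over the
-- drivers gives #{i : p_i ∈ T_v} = #{drivers parked in T_v} + #{crossings of v → parent v}.
-- When all n drivers park on the n vertices every vertex is taken, so the middle term is |T_v|;
-- hence the inequality defining primality at v says exactly that the edge v → parent v is used.
module Submission where

open import Defs
open import Data.Bool using (Bool; true; false; not; _∧_; _∨_)
open import Data.Bool.Properties using (∧-zeroʳ; ∧-identityʳ; ∨-zeroʳ; ¬-not)
  renaming (_≟_ to _≟B_)
open import Data.Empty using (⊥-elim)
open import Data.Fin using (Fin; toℕ) renaming (zero to fzero; suc to fsuc)
open import Data.Fin.Properties using (_≟_; pigeonhole; toℕ<n)
open import Data.List using (List; []; _∷_; map; length; filter; tabulate; allFin)
open import Data.List.Properties using (length-map; length-tabulate)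
open import Data.List.Relation.Unary.All using (All; []; _∷_)
open import Data.List.Relation.Unary.Any using (Any; here; there)
open import Data.List.Membership.Propositional using (_∈_)
open import Data.Maybe using (just; Is-just; maybe′)
open import Data.Maybe.Properties using (just-injective)
open import Data.Nat using (ℕ; zero; suc; _+_; _*_; _∸_; _≤_; _<_; _≤?_; z≤n; s≤s; s≤s⁻¹)
open import Data.Nat.Properties
  using ( +-0-commutativeMonoid; +-commutativeSemigroup; +-identityʳ; +-assoc; m≤m*n; n<1+n
        ; +-cancelˡ-≡; +-cancelˡ-<; m+n≡0⇒m≡0; m+n≡0⇒n≡0; m∸n+n≡m; m<n⇒0<n∸m; m<m+n
        ; m≤m+n; m≤n+m; m≤n⇒m<n∨m≡n; n≤0⇒n≡0; ≰⇒>; <⇒≤; ≤-refl; ≤-trans; ≤-reflexive)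
open import Algebra.Properties.CommutativeMonoid.Sum +-0-commutativeMonoid
  using (sum-syntax; sum-cong-≗; ∑-distrib-+; sum-replicate-zero)
open import Algebra.Properties.CommutativeSemigroup +-commutativeSemigroup
  using (interchange; x∙yz≈y∙xz)
open import Data.Product using (_,_; proj₁; proj₂; ∃)
open import Data.Sum using (inj₁; inj₂)
open import Function using (_∘_; id)
open import Function.Bundles using (_⇔_; mk⇔; Equivalence)
import Function.Properties.Equivalence as ⇔
open import Relation.Nullary using (¬_; does; yes; no)
open import Relation.Nullary.Decidable using (dec-true)
open import Relation.Binary.PropositionalEquality

𝟙 : Bool → ℕ
𝟙 true  = 1
𝟙 false = 0

𝟙-∧-≤ : ∀ x y → 𝟙 (x ∧ y) ≤ 𝟙 y
𝟙-∧-≤ true  y = ≤-refl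
𝟙-∧-≤ false y = z≤n

≡true⇔⇒≡ : ∀ {x y : Bool} → x ≡ true ⇔ y ≡ true → x ≡ y
≡true⇔⇒≡ {true}  x⇔y = sym (Equivalence.to x⇔y refl)
≡true⇔⇒≡ {false} {false} x⇔y = refl
≡true⇔⇒≡ {false} {true}  x⇔y = Equivalence.from x⇔y refl

m<m+n⇔0<n : ∀ m {n} → m < m + n ⇔ 0 < n
m<m+n⇔0<n m {n} = mk⇔ (+-cancelˡ-< m 0 n ∘ subst (_< m + n) (sym (+-identityʳ m))) (m<m+n m)

count : {A : Set} → (A → Bool) → List A → ℕ
count X []       = 0
count X (x ∷ xs) = 𝟙 (X x) + count X xs

length-filter-≡true : {A : Set} (X : A → Bool) (xs : List A) →
  length (filter (λ x → X x ≟B true) xs) ≡ count X xs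
length-filter-≡true X [] = refl
length-filter-≡true X (x ∷ xs) with X x
... | true  = cong suc (length-filter-≡true X xs)
... | false = length-filter-≡true X xs

count-map : {A B : Set} (X : B → Bool) (f : A → B) (xs : List A) →
  count X (map f xs) ≡ count (X ∘ f) xs
count-map X f []       = refl
count-map X f (x ∷ xs) = cong (𝟙 (X (f x)) +_) (count-map X f xs)

count-tabulate : {A : Set} {m : ℕ} (X : A → Bool) (f : Fin m → A) →
  count X (tabulate f) ≡ ∑[ i < m ] 𝟙 (X (f i))
count-tabulate {m = zero}  X f = refl
count-tabulate {m = suc m} X f = cong (𝟙 (X (f fzero)) +_) (count-tabulate X (f ∘ fsuc))

sum-ones : ∀ m → ∑[ i < m ] 1 ≡ m
sum-ones zero    = refl
sum-ones (suc m) = cong suc (sum-ones m)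

sum≡0⇒≡0 : ∀ {m} (f : Fin m → ℕ) → ∑[ i < m ] f i ≡ 0 → ∀ i → f i ≡ 0
sum≡0⇒≡0 f eq fzero    = m+n≡0⇒m≡0 (f fzero) eq
sum≡0⇒≡0 f eq (fsuc i) = sum≡0⇒≡0 (f ∘ fsuc) (m+n≡0⇒n≡0 (f fzero) eq) i

sum-singleton : ∀ {m} (X : Fin m → Bool) (w : Fin m) → ∑[ u < m ] 𝟙 (X u ∧ does (u ≟ w)) ≡ 𝟙 (X w)
sum-singleton {suc m} X fzero = begin
  𝟙 (X fzero ∧ true) + ∑[ u < m ] 𝟙 (X (fsuc u) ∧ false)
    ≡⟨ cong₂ _+_ (cong 𝟙 (∧-identityʳ (X fzero))) (sum-cong-≗ (cong 𝟙 ∘ ∧-zeroʳ ∘ X ∘ fsuc)) ⟩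
  𝟙 (X fzero) + ∑[ u < m ] 0
    ≡⟨ cong (𝟙 (X fzero) +_) (sum-replicate-zero m) ⟩
  𝟙 (X fzero) + 0
    ≡⟨ +-identityʳ _ ⟩
  𝟙 (X fzero) ∎
  where open ≡-Reasoning
sum-singleton {suc m} X (fsuc w) =
  cong₂ _+_ (cong 𝟙 (∧-zeroʳ (X fzero))) (sum-singleton (X ∘ fsuc) w)

module _ {A : Set} (f : A → A) where

  iterate-+ : ∀ j k x → iterate f (j + k) x ≡ iterate f j (iterate f k x)
  iterate-+ zero    k x = refl
  iterate-+ (suc j) k x = cong f (iterate-+ j k x)

  iterate-∸ : ∀ {i k} x → i ≤ k → iterate f k x ≡ iterate f (k ∸ i) (iterate f i x)
  iterate-∸ {i} {k} x i≤k = trans (cong (λ j → iterate f j x) (sym (m∸n+n≡m i≤k))) (iterate-+ (k ∸ i) i x)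

  iterate-suc : ∀ k x → iterate f (suc k) x ≡ iterate f k (f x)
  iterate-suc zero    x = refl
  iterate-suc (suc k) x = cong f (iterate-suc k x)

  iterate-fixed : ∀ {x} → f x ≡ x → ∀ k → iterate f k x ≡ x
  iterate-fixed fx≡x zero    = refl
  iterate-fixed fx≡x (suc k) = trans (cong f (iterate-fixed fx≡x k)) fx≡x

  iterate-periodic : ∀ {m x} → iterate f m x ≡ x → ∀ k → iterate f (k * m) x ≡ x
  iterate-periodic per zero    = refl
  iterate-periodic {m} {x} per (suc k) =
    trans (iterate-+ m (k * m) x) (trans (cong (iterate f m) (iterate-periodic per k)) per)

module _ {n : ℕ} (T : RootedTree n) where

  _↝_ : Fin n → Fin n → Set
  u ↝ v = ∃ λ k → iterate (parent T) k u ≡ v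

  root-absorbing : ∀ {i k x} → iterate (parent T) i x ≡ root T → i ≤ k → iterate (parent T) k x ≡ root T
  root-absorbing {i} {k} {x} xi≡r i≤k = begin
    iterate (parent T) k x                              ≡⟨ iterate-∸ (parent T) x i≤k ⟩
    iterate (parent T) (k ∸ i) (iterate (parent T) i x) ≡⟨ cong (iterate (parent T) (k ∸ i)) xi≡r ⟩
    iterate (parent T) (k ∸ i) (root T)                 ≡⟨ iterate-fixed (parent T) (parent-root T) (k ∸ i) ⟩
    root T                                              ∎
    where open ≡-Reasoning

  periodic⇒root : ∀ {m x} → 0 < m → iterate (parent T) m x ≡ x → x ≡ root T
  periodic⇒root {suc m} {x} _ per with reaches T x
  ... | k , xk≡r = trans (sym (iterate-periodic (parent T) per k)) (root-absorbing xk≡r (m≤m*n k (suc m)))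

  -- Among the first n + 1 ancestors of u two coincide; the earlier one is periodic, hence the root.
  path-length≤n : ∀ {k u v} → iterate (parent T) k u ≡ v → v ≢ root T → k ≤ n
  path-length≤n {k} {u} uk≡v v≢r with k ≤? n
  ... | yes k≤n = k≤n
  ... | no k≰n with pigeonhole (n<1+n n) (λ i → iterate (parent T) (toℕ i) u)
  ... | i , j , i<j , ui≡uj = ⊥-elim (v≢r (trans (sym uk≡v) (root-absorbing ui≡r i≤k)))
    where
    i≤k : toℕ i ≤ k
    i≤k = ≤-trans (<⇒≤ i<j) (≤-trans (s≤s⁻¹ (toℕ<n j)) (<⇒≤ (≰⇒> k≰n)))
    ui≡r : iterate (parent T) (toℕ i) u ≡ root T
    ui≡r = periodic⇒root (m<n⇒0<n∸m i<j) (trans (sym (iterate-∸ (parent T) u (<⇒≤ i<j))) (sym ui≡uj))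

  pathTo-complete : ∀ {k u v} m → k ≤ m → iterate (parent T) k u ≡ v → pathTo T m u v ≡ true
  pathTo-complete {u = u} {v} zero z≤n u≡v = dec-true (u ≟ v) u≡v
  pathTo-complete {k} {u} {v} (suc m) k≤1+m uk≡v with m≤n⇒m<n∨m≡n k≤1+m
  ... | inj₁ k<1+m = trans (cong (does (iterate (parent T) (suc m) u ≟ v) ∨_)
                                 (pathTo-complete {k} m (s≤s⁻¹ k<1+m) uk≡v)) (∨-zeroʳ _)
  ... | inj₂ refl  = cong (_∨ pathTo T m u v) (dec-true (iterate (parent T) k u ≟ v) uk≡v)

  pathTo-sound : ∀ m {u v} → pathTo T m u v ≡ true → u ↝ v
  pathTo-sound zero {u} {v} eq with u ≟ v
  ... | yes u≡v = 0 , u≡v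
  pathTo-sound zero () | no _
  pathTo-sound (suc m) {u} {v} eq with iterate (parent T) (suc m) u ≟ v
  ... | yes uk≡v = suc m , uk≡v
  ... | no _     = pathTo-sound m eq

  inSubtree⇔↝ : ∀ {u v} → v ≢ root T → inSubtree T v u ≡ true ⇔ u ↝ v
  inSubtree⇔↝ v≢r = mk⇔ (pathTo-sound n)
    (λ (k , uk≡v) → pathTo-complete {k} n (path-length≤n {k} uk≡v v≢r) uk≡v)

  ↝⇔parent↝ : ∀ {u v} → u ≢ v → u ↝ v ⇔ parent T u ↝ v
  ↝⇔parent↝ {u} u≢v = mk⇔
    (λ { (zero , u≡v) → ⊥-elim (u≢v u≡v)
       ; (suc k , eq) → k , trans (sym (iterate-suc (parent T) k u)) eq })
    (λ (k , eq) → suc k , trans (iterate-suc (parent T) k u) eq)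

  parent-¬↝ : ∀ {v} → v ≢ root T → ¬ (parent T v ↝ v)
  parent-¬↝ {v} v≢r (k , eq) = v≢r (periodic⇒root {suc k} (s≤s z≤n) (trans (iterate-suc (parent T) k v) eq))

  subtree-step : ∀ {v} → v ≢ root T → ∀ u →
    𝟙 (inSubtree T v u) ≡ 𝟙 (does (u ≟ v)) + 𝟙 (inSubtree T v (parent T u))
  subtree-step {v} v≢r u with u ≟ v
  ... | yes refl = trans (cong 𝟙 v∈T_v) (cong (suc ∘ 𝟙) (sym parent∉T_v))
    where
    v∈T_v : inSubtree T v v ≡ true
    v∈T_v = Equivalence.from (inSubtree⇔↝ v≢r) (0 , refl)
    parent∉T_v : inSubtree T v (parent T v) ≡ false
    parent∉T_v = ¬-not (parent-¬↝ v≢r ∘ Equivalence.to (inSubtree⇔↝ v≢r))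
  ... | no u≢v = cong 𝟙 (≡true⇔⇒≡
    (⇔.trans (inSubtree⇔↝ v≢r) (⇔.trans (↝⇔parent↝ u≢v) (⇔.sym (inSubtree⇔↝ v≢r)))))

  occurrences : Fin n → List (Fin n) → ℕ
  occurrences v = count (λ x → does (x ≟ v))

  search-spot-free : ∀ f occ a {w} → proj₂ (search T f occ a) ≡ just w → occ w ≡ false
  search-spot-free zero occ a ()
  search-spot-free (suc f) occ a eq with occ a in occ-a
  ... | false = subst (λ x → occ x ≡ false) (just-injective eq) occ-a
  ... | true with a ≟ root T
  search-spot-free (suc f) occ a () | true | yes _
  ... | no _ = search-spot-free f occ (parent T a) eq

  search-balance : ∀ {v} → v ≢ root T → ∀ f occ a {w} → proj₂ (search T f occ a) ≡ just w →
    𝟙 (inSubtree T v a) ≡ 𝟙 (inSubtree T v w) + occurrences v (proj₁ (search T f occ a))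
  search-balance v≢r zero occ a ()
  search-balance v≢r (suc f) occ a eq with occ a
  ... | false rewrite just-injective eq = sym (+-identityʳ _)
  ... | true with a ≟ root T
  search-balance v≢r (suc f) occ a () | true | yes _
  search-balance {v} v≢r (suc f) occ a {w} eq | true | no _ = begin
    𝟙 (S a)                           ≡⟨ subtree-step v≢r a ⟩
    𝟙 (does (a ≟ v)) + 𝟙 (S (parent T a))
      ≡⟨ cong (𝟙 (does (a ≟ v)) +_) (search-balance v≢r f occ (parent T a) eq) ⟩
    𝟙 (does (a ≟ v)) + (𝟙 (S w) + occurrences v path)
      ≡⟨ x∙yz≈y∙xz (𝟙 (does (a ≟ v))) (𝟙 (S w)) _ ⟩
    𝟙 (S w) + (𝟙 (does (a ≟ v)) + occurrences v path) ∎
    where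
    open ≡-Reasoning
    S : Fin n → Bool
    S = inSubtree T v
    path : List (Fin n)
    path = proj₁ (search T f occ (parent T a))

  everywhere : Fin n → Bool
  everywhere _ = true

  AllParked : List (Outcome T) → Set
  AllParked = All (Is-just ∘ proj₂)

  occupancyAfter : Occupancy T → List (Fin n) → Occupancy T
  occupancyAfter occ []       = occ
  occupancyAfter occ (a ∷ as) = occupancyAfter (occupy T occ (proj₂ (search T n occ a))) as

  parkedIn : (Fin n → Bool) → List (Outcome T) → ℕ
  parkedIn X = count (maybe′ X false ∘ proj₂)

  freeIn : (Fin n → Bool) → Occupancy T → ℕ
  freeIn X occ = ∑[ u < n ] 𝟙 (X u ∧ not (occ u))

  -- Crossings are counted with multiplicity: this keeps search-balance additive, and only
  -- positivity matters in the end.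
  crossings : Fin n → List (Outcome T) → ℕ
  crossings v []       = 0
  crossings v (o ∷ os) = occurrences v (proj₁ o) + crossings v os

  freeIn-occupy : ∀ X occ {w} → occ w ≡ false →
    freeIn X occ ≡ 𝟙 (X w) + freeIn X (occupy T occ (just w))
  freeIn-occupy X occ {w} occ-w = begin
    freeIn X occ
      ≡⟨ sum-cong-≗ split ⟩
    ∑[ u < n ] (𝟙 (X u ∧ does (u ≟ w)) + 𝟙 (X u ∧ not (occ′ u)))
      ≡⟨ ∑-distrib-+ (λ u → 𝟙 (X u ∧ does (u ≟ w))) (λ u → 𝟙 (X u ∧ not (occ′ u))) ⟩
    ∑[ u < n ] 𝟙 (X u ∧ does (u ≟ w)) + freeIn X occ′
      ≡⟨ cong (_+ freeIn X occ′) (sum-singleton X w) ⟩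
    𝟙 (X w) + freeIn X occ′ ∎
    where
    open ≡-Reasoning
    occ′ : Occupancy T
    occ′ = occupy T occ (just w)
    split : ∀ u → 𝟙 (X u ∧ not (occ u)) ≡ 𝟙 (X u ∧ does (u ≟ w)) + 𝟙 (X u ∧ not (occ′ u))
    split u with u ≟ w
    ... | yes refl rewrite occ-w =
      sym (trans (cong (λ k → 𝟙 (X u ∧ true) + 𝟙 k) (∧-zeroʳ (X u))) (+-identityʳ _))
    ... | no _     = cong (λ k → 𝟙 k + 𝟙 (X u ∧ not (occ u))) (sym (∧-zeroʳ (X u)))

  freeIn-run : ∀ X occ as → AllParked (run T occ as) →
    freeIn X occ ≡ parkedIn X (run T occ as) + freeIn X (occupancyAfter occ as)
  freeIn-run X occ [] [] = refl
  freeIn-run X occ (a ∷ as) (parked ∷ rest) with proj₂ (search T n occ a) in spot | parked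
  ... | just w | _ = begin
    freeIn X occ
      ≡⟨ freeIn-occupy X occ (search-spot-free n occ a spot) ⟩
    𝟙 (X w) + freeIn X occ′
      ≡⟨ cong (𝟙 (X w) +_) (freeIn-run X occ′ as rest) ⟩
    𝟙 (X w) + (parkedIn X (run T occ′ as) + freeIn X (occupancyAfter occ′ as))
      ≡⟨ +-assoc (𝟙 (X w)) _ _ ⟨
    𝟙 (X w) + parkedIn X (run T occ′ as) + freeIn X (occupancyAfter occ′ as) ∎
    where
    open ≡-Reasoning
    occ′ : Occupancy T
    occ′ = occupy T occ (just w)

  freeIn-everywhere≡0 : ∀ X occ → freeIn everywhere occ ≡ 0 → freeIn X occ ≡ 0
  freeIn-everywhere≡0 X occ none = trans (sum-cong-≗ vanish) (sum-replicate-zero n)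
    where
    vanish : ∀ u → 𝟙 (X u ∧ not (occ u)) ≡ 0
    vanish u = n≤0⇒n≡0 (≤-trans (𝟙-∧-≤ (X u) _) (≤-reflexive (sum≡0⇒≡0 _ none u)))

  parkedIn-everywhere≡length : ∀ os → AllParked os → parkedIn everywhere os ≡ length os
  parkedIn-everywhere≡length []       []              = refl
  parkedIn-everywhere≡length (o ∷ os) (parked ∷ rest) with proj₂ o | parked
  ... | just _ | _ = cong suc (parkedIn-everywhere≡length os rest)

  length-run : ∀ occ as → length (run T occ as) ≡ length as
  length-run occ []       = refl
  length-run occ (a ∷ as) = cong suc (length-run _ as)

  -- n drivers park on n distinct vertices, so no vertex is left free.
  parkedIn-outcomes : ∀ p → IsParkingFunction T p → ∀ X → parkedIn X (outcomes T p) ≡ ∑[ u < n ] 𝟙 (X u)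
  parkedIn-outcomes p pf X = begin
    parkedIn X os                   ≡⟨ +-identityʳ _ ⟨
    parkedIn X os + 0               ≡⟨ cong (parkedIn X os +_) (freeIn-everywhere≡0 X final none-free) ⟨
    parkedIn X os + freeIn X final  ≡⟨ freeIn-run X empty as pf ⟨
    freeIn X empty                  ≡⟨ sum-cong-≗ (cong 𝟙 ∘ ∧-identityʳ ∘ X) ⟩
    ∑[ u < n ] 𝟙 (X u)              ∎
    where
    open ≡-Reasoning
    empty : Occupancy T
    empty _ = false
    as : List (Fin n)
    as = map p (allFin n)
    os : List (Outcome T)
    os = run T empty as
    final : Occupancy T
    final = occupancyAfter empty as
    all-parked : parkedIn everywhere os ≡ n
    all-parked = trans (parkedIn-everywhere≡length os pf)
      (trans (length-run empty as) (trans (length-map p (allFin n)) (length-tabulate id)))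
    none-free : freeIn everywhere final ≡ 0
    none-free = +-cancelˡ-≡ n _ 0 (begin
      n + freeIn everywhere final                       ≡⟨ cong (_+ freeIn everywhere final) all-parked ⟨
      parkedIn everywhere os + freeIn everywhere final  ≡⟨ freeIn-run everywhere empty as pf ⟨
      freeIn everywhere empty                           ≡⟨ sum-ones n ⟩
      n                                                 ≡⟨ +-identityʳ n ⟨
      n + 0                                             ∎)

  run-balance : ∀ {v} → v ≢ root T → ∀ occ as → AllParked (run T occ as) →
    count (inSubtree T v) as ≡ parkedIn (inSubtree T v) (run T occ as) + crossings v (run T occ as)
  run-balance v≢r occ [] [] = refl
  run-balance {v} v≢r occ (a ∷ as) (parked ∷ rest) with proj₂ (search T n occ a) in spot | parked
  ... | just w | _ = begin
    𝟙 (S a) + count S as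
      ≡⟨ cong₂ _+_ (search-balance v≢r n occ a spot) (run-balance v≢r occ′ as rest) ⟩
    (𝟙 (S w) + occurrences v path) + (parkedIn S (run T occ′ as) + crossings v (run T occ′ as))
      ≡⟨ interchange (𝟙 (S w)) _ _ _ ⟩
    (𝟙 (S w) + parkedIn S (run T occ′ as)) + (occurrences v path + crossings v (run T occ′ as)) ∎
    where
    open ≡-Reasoning
    S : Fin n → Bool
    S = inSubtree T v
    occ′ : Occupancy T
    occ′ = occupy T occ (just w)
    path : List (Fin n)
    path = proj₁ (search T n occ a)

  subtreeSize≡sum : ∀ v → subtreeSize T v ≡ ∑[ u < n ] 𝟙 (inSubtree T v u)
  subtreeSize≡sum v = trans (length-filter-≡true (inSubtree T v) (allFin n)) (count-tabulate (inSubtree T v) id)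

  driversIn≡subtreeSize+crossings : ∀ p → IsParkingFunction T p → ∀ {v} → v ≢ root T →
    driversIn T p v ≡ subtreeSize T v + crossings v (outcomes T p)
  driversIn≡subtreeSize+crossings p pf {v} v≢r = begin
    driversIn T p v                          ≡⟨ length-filter-≡true (S ∘ p) (allFin n) ⟩
    count (S ∘ p) (allFin n)                 ≡⟨ count-map S p (allFin n) ⟨
    count S (map p (allFin n))               ≡⟨ run-balance v≢r _ _ pf ⟩
    parkedIn S os + crossings v os           ≡⟨ cong (_+ crossings v os) (parkedIn-outcomes p pf S) ⟩
    ∑[ u < n ] 𝟙 (S u) + crossings v os      ≡⟨ cong (_+ crossings v os) (subtreeSize≡sum v) ⟨
    subtreeSize T v + crossings v os         ∎
    where
    open ≡-Reasoning
    S : Fin n → Bool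
    S = inSubtree T v
    os : List (Outcome T)
    os = outcomes T p

  occurrences-pos⇔∈ : ∀ v xs → 0 < occurrences v xs ⇔ v ∈ xs
  occurrences-pos⇔∈ v xs = mk⇔ (to xs) (from xs)
    where
    to : ∀ xs → 0 < occurrences v xs → v ∈ xs
    to (x ∷ xs) pos with x ≟ v
    ... | yes refl = here refl
    ... | no _     = there (to xs pos)
    from : ∀ xs → v ∈ xs → 0 < occurrences v xs
    from (x ∷ xs) (here refl) rewrite dec-true (x ≟ x) refl = s≤s z≤n
    from (x ∷ xs) (there v∈xs) = ≤-trans (from xs v∈xs) (m≤n+m _ _)

  crossings-pos⇔edgeUsed : ∀ v os → 0 < crossings v os ⇔ Any (λ o → v ∈ proj₁ o) os
  crossings-pos⇔edgeUsed v os = mk⇔ (to os) (from os)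
    where
    to : ∀ os → 0 < crossings v os → Any (λ o → v ∈ proj₁ o) os
    to (o ∷ os) pos with occurrences v (proj₁ o) in occ
    ... | zero  = there (to os pos)
    ... | suc _ = here (Equivalence.to (occurrences-pos⇔∈ v (proj₁ o)) (subst (0 <_) (sym occ) (s≤s z≤n)))
    from : ∀ os → Any (λ o → v ∈ proj₁ o) os → 0 < crossings v os
    from (o ∷ os) (here v∈o) =
      ≤-trans (Equivalence.from (occurrences-pos⇔∈ v (proj₁ o)) v∈o) (m≤m+n _ _)
    from (o ∷ os) (there used) = ≤-trans (from os used) (m≤n+m _ _)

  prime-at⇔edgeUsed : ∀ p → IsParkingFunction T p → ∀ {v} → v ≢ root T →
    subtreeSize T v < driversIn T p v ⇔ EdgeUsed T p v
  prime-at⇔edgeUsed p pf {v} v≢r rewrite driversIn≡subtreeSize+crossings p pf v≢r =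
    ⇔.trans (m<m+n⇔0<n (subtreeSize T v)) (crossings-pos⇔edgeUsed v (outcomes T p))

corollary2p5 : (n : ℕ) (T : RootedTree n) (p : Fin n → Fin n) →
    IsParkingFunction T p → (IsPrime T p ⇔ AllEdgesUsed T p)
corollary2p5 n T p pf = mk⇔
  (λ prime v v≢r → Equivalence.to (prime-at⇔edgeUsed T p pf v≢r) (prime v v≢r))
  (λ used v v≢r → Equivalence.from (prime-at⇔edgeUsed T p pf v≢r) (used v v≢r))
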